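{- Let $d,g$ be coprime positive integers with $g>d\geq 2$, and let $h:\mathbb{Z}\to\mathbb{Z}$ satisfy (1) $h(x+d)=h(x)$ for all $x$, (2) $x+h(x)\equiv 0 \pmod d$ for all $x$, and (3) $0<|h(x)|<g$ for all $x$ not divisible by $d$. Let $\Pi$ be the set of positive integers divisible neither by $d$ nor by $g$, let $E$ be the set of integers in $[1,dg]$ divisible neither by $d$ nor by $g$, and let $T:\Pi\to\Pi$ and the $m$-path $\gamma_m$ be as defined in the context. Fix $m\geq 1$, positive integers $k_1,\dots,k_m$, and $\varepsilon\in E$, and let $k=k_1+\dots+k_m$. Then there exist $(d-1)^m$ triples $(q^{(i)},r^{(i)},\delta^{(i)})$, $i=1,\dots,(d-1)^m$, with $0\leq q^{(i)}<d^{k}$, $0\leq r^{(i)}<g^m$ and $\delta^{(i)}\in E$, such that \[ \{x\in\Pi : x\equiv\varepsilon \pmod{dg},\ \gamma_m(x)=(k_1,\dots,k_m)\}=\{dg(d^{k}p+q^{(i)})+\varepsilon\}_{p\geq 0,\ 1\leq i\leq (d-1)^m}. \] Moreover, for all $p\geq 0$ and all $i$, $T^m\big(dg(d^kp+q^{(i)})+\varepsilon\big)=dg(g^mp+r^{(i)})+\delta^{(i)}$.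
   Context: For $x\in\Pi$, the map is $T(x)=\frac{gx+h(gx)}{d^{k}}$, where $k\geq 1$ is the unique integer such that $\frac{gx+h(gx)}{d^k}$ is an integer not divisible by $d$ (equivalently, the largest $k$ for which it is an integer); then $T(x)\in\Pi$. For $x\in\Pi$, write $k(x)$ for this exponent. The $m$-path of $x$ is the ordered $m$-tuple $\gamma_m(x)=(k(x),k(T(x)),\dots,k(T^{m-1}(x)))$ of exponents arising in the first $m$ iterations of $T$. -}

module Defs where

open import Data.Nat using (ℕ; zero; suc; _+_; _*_; _^_; _≤_; _<_)
open import Data.Nat.Divisibility using (_∣_)
open import Data.Integer as ℤ using (ℤ; +_)
open import Data.Vec using (Vec; []; _∷_)
open import Data.Product using (_×_)
open import Relation.Nullary using (¬_)
open import Relation.Binary.PropositionalEquality using (_≡_)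

InΠ : ℕ → ℕ → ℕ → Set
InΠ d g x = 0 < x × ¬ (d ∣ x) × ¬ (g ∣ x)

InE : ℕ → ℕ → ℕ → Set
InE d g x = 1 ≤ x × x ≤ d * g × ¬ (d ∣ x) × ¬ (g ∣ x)

-- One step of T with exponent k:  k ≥ 1 and (g x + h (g x)) / d^k = y
-- is an integer not divisible by d (this is exactly the defining
-- property of k(x) and T(x) in the paper).
Step : ℕ → ℕ → (ℤ → ℤ) → ℕ → ℕ → ℕ → Set
Step d g h x k y =
  1 ≤ k × ((+ (g * x)) ℤ.+ h (+ (g * x)) ≡ + (d ^ k * y)) × ¬ (d ∣ y)

-- Path d g h x (k₁ ∷ … ∷ kₘ) z :  γₘ(x) = (k₁,…,kₘ) and Tᵐ(x) = z
data Path (d g : ℕ) (h : ℤ → ℤ) : {m : ℕ} → ℕ → Vec ℕ m → ℕ → Set where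
  done : ∀ {x} → Path d g h x [] x
  step : ∀ {m x k y z} {ks : Vec ℕ m} →
         Step d g h x k y → Path d g h y ks z → Path d g h x (k ∷ ks) z

module Submission where

-- Write x = dg n + ε. As h has period d, g x + h (g x) = d (g² n + a) with a depending only on ε,
-- and a < g², g ∤ a. So the first exponent is k exactly when g² n + a ≡ d^(k-1) J (mod dᵏ) for
-- some J ∈ {1, …, d-1}; g being invertible modulo dᵏ, this fixes n modulo dᵏ, one class for each J,
-- and on the class n = dᵏ p + q the image is T(x) = dg (g p + r) + δ with r < g and δ ∈ E.
-- Induction on m: the remaining steps fix g p + r modulo d^(k₂+…+kₘ), hence p modulo that power,
-- which yields (d-1)^m classes modulo d^(k₁+…+kₘ), each mapped affinely by Tᵐ.

open import Defs
open import Data.Nat using (ℕ; zero; suc; _+_; _*_; _^_; _≤_; _<_; _∸_; z≤n; s≤s; NonZero; >-nonZero)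
open import Data.Nat.Properties
open import Data.Nat.DivMod
open import Data.Nat.Divisibility
  using (_∣_; divides; ∣1⇒≡1; ∣-trans; m%n≡0⇒n∣m; ∣m∣n⇒∣m+n; ∣m+n∣m⇒∣n; m∣m*n; n∣m*n; ∣⇒≤)
open import Data.Nat.Coprimality using (Coprime; coprime-Bézout; coprime-divisor)
import Data.Nat.Coprimality as Cop
import Data.Nat.GCD as GCD
open import Data.Nat.Tactic.RingSolver using (solve-∀)
open import Data.Integer as ℤ using (ℤ; +_; -[1+_]; ∣_∣)
import Data.Integer.Properties as ℤP
open import Data.Integer.Divisibility as ℤD using ()
import Data.Integer.Tactic.RingSolver as ℤS
open import Data.Fin as Fin using (Fin; toℕ; fromℕ<; remQuot; combine)
open import Data.Fin.Properties using (toℕ<n; toℕ-fromℕ<; toℕ-injective; remQuot-combine; combine-remQuot)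
open import Data.Vec using (Vec; []; _∷_; sum)
open import Data.Vec.Relation.Unary.All using (All; []; _∷_)
open import Data.Sum using (inj₁; inj₂)
open import Data.Product using (_×_; Σ; ∃; ∃-syntax; _,_; proj₁; proj₂; uncurry)
open import Function using (_∘_)
open import Function.Definitions using (Injective)
open import Level using (0ℓ)
open import Relation.Binary using (Rel; Setoid)
import Relation.Binary.Construct.On as On
import Relation.Binary.Reasoning.Setoid as SetoidReasoning
open import Relation.Nullary using (¬_; contradiction)
open import Relation.Binary.PropositionalEquality

coprime-*ʳ : ∀ {a b c} → Coprime a b → Coprime a c → Coprime a (b * c)
coprime-*ʳ a⊥b a⊥c (i∣a , i∣bc) =
  a⊥c (i∣a , coprime-divisor (λ (j∣i , j∣b) → a⊥b (∣-trans j∣i i∣a , j∣b)) i∣bc)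

coprime-^ʳ : ∀ {a b} → Coprime a b → ∀ e → Coprime a (b ^ e)
coprime-^ʳ a⊥b zero    (_ , i∣1) = ∣1⇒≡1 i∣1
coprime-^ʳ a⊥b (suc e) = coprime-*ʳ a⊥b (coprime-^ʳ a⊥b e)

m≡n*[m/n]+m%n : ∀ m n .{{_ : NonZero n}} → m ≡ n * (m / n) + m % n
m≡n*[m/n]+m%n m n =
  trans (m≡m%n+[m/n]*n m n) (trans (+-comm (m % n) _) (cong (_+ m % n) (*-comm (m / n) n)))

[n*o+m]%n≡m : ∀ {m} n o .{{_ : NonZero n}} → m < n → (n * o + m) % n ≡ m
[n*o+m]%n≡m {m} n o m<n = begin
  (n * o + m) % n ≡⟨ cong (_% n) (trans (+-comm (n * o) m) (cong (λ z → m + z) (*-comm n o))) ⟩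
  (m + o * n) % n ≡⟨ [m+kn]%n≡m%n m o n ⟩
  m % n           ≡⟨ m<n⇒m%n≡m m<n ⟩
  m               ∎
  where open ≡-Reasoning

n*o+m<n*p : ∀ {m} n {o p} → m < n → o < p → n * o + m < n * p
n*o+m<n*p {m} n {o} {p} m<n o<p = begin-strict
  n * o + m <⟨ +-monoʳ-< (n * o) m<n ⟩
  n * o + n ≡⟨ trans (+-comm (n * o) n) (sym (*-suc n o)) ⟩
  n * suc o ≤⟨ *-monoʳ-≤ n o<p ⟩
  n * p     ∎
  where open ≤-Reasoning

digit : ∀ {k} → Fin k → ℕ
digit j = suc (toℕ j)

digit<n : ∀ {n} (j : Fin (n ∸ 1)) → digit j < n
digit<n {suc n} j = s≤s (toℕ<n j)

digit-injective : ∀ {k} {i j : Fin k} → digit i ≡ digit j → i ≡ j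
digit-injective eq = toℕ-injective (suc-injective eq)

%-digit : ∀ {n} m .{{_ : NonZero n}} → ¬ n ∣ m → ∃[ j ] m % n ≡ digit {n ∸ 1} j
%-digit {suc n} m n∤m with m % suc n in eq | m%n<n m (suc n)
... | zero  | _         = contradiction (m%n≡0⇒n∣m m (suc n) eq) n∤m
... | suc r | s≤s r<n   = fromℕ< r<n , cong suc (sym (toℕ-fromℕ< r<n))

quot⁺ : ℕ → (N : ℕ) .{{_ : NonZero N}} → ℕ
quot⁺ w N = (w ∸ 1) / N

rem⁺ : ℕ → (N : ℕ) .{{_ : NonZero N}} → ℕ
rem⁺ w N = suc ((w ∸ 1) % N)

m≡n*quot⁺+rem⁺ : ∀ {w} N .{{_ : NonZero N}} → 1 ≤ w → w ≡ N * quot⁺ w N + rem⁺ w N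
m≡n*quot⁺+rem⁺ {suc w} N _ = trans (cong suc (m≡n*[m/n]+m%n w N)) (sym (+-suc _ _))

quot⁺<n : ∀ {w n} N .{{_ : NonZero N}} → 1 ≤ w → w ≤ n * N → quot⁺ w N < n
quot⁺<n {suc w} N _ w≤nN = m<n*o⇒m/o<n w≤nN

rem⁺-InE : ∀ {d g w} .{{_ : NonZero (d * g)}} →
           1 ≤ w → ¬ d ∣ w → ¬ g ∣ w → InE d g (rem⁺ w (d * g))
rem⁺-InE {d} {g} {w} 1≤w d∤w g∤w =
  s≤s z≤n , m%n<n (w ∸ 1) (d * g) , d∤w ∘ ∣rem⁺ (m∣m*n g) , g∤w ∘ ∣rem⁺ (n∣m*n d)
  where
  ∣rem⁺ : ∀ {m} → m ∣ d * g → m ∣ rem⁺ w (d * g) → m ∣ w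
  ∣rem⁺ m∣dg m∣rem =
    subst (_ ∣_) (sym (m≡n*quot⁺+rem⁺ (d * g) 1≤w)) (∣m∣n⇒∣m+n (∣-trans m∣dg (m∣m*n _)) m∣rem)

uncurry-remQuot-injective : ∀ {a} {A : Set a} {m n} (f : Fin m → Fin n → A) →
                            (∀ {i j i' j'} → f i j ≡ f i' j' → (i , j) ≡ (i' , j')) →
                            Injective _≡_ _≡_ (uncurry f ∘ remQuot n)
uncurry-remQuot-injective {m = m} {n} f f-injective {c} {c'} fc≡fc' = begin
  c                                  ≡⟨ combine-remQuot {m} n c ⟨
  uncurry combine (remQuot {m} n c)  ≡⟨ cong (uncurry combine) (f-injective fc≡fc') ⟩
  uncurry combine (remQuot {m} n c') ≡⟨ combine-remQuot {m} n c' ⟩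
  c'                                 ∎
  where open ≡-Reasoning

module Modular (N : ℕ) .{{_ : NonZero N}} where

  infix 4 _≈_
  _≈_ : Rel ℕ 0ℓ
  a ≈ b = a % N ≡ b % N

  ≈-setoid : Setoid 0ℓ 0ℓ
  ≈-setoid = On.setoid (setoid ℕ) (_% N)

  open Setoid ≈-setoid public using () renaming (refl to ≈-refl; sym to ≈-sym; trans to ≈-trans)
  module ≈-Reasoning = SetoidReasoning ≈-setoid

  +-cong : ∀ {a b c e} → a ≈ b → c ≈ e → a + c ≈ b + e
  +-cong {a} {b} {c} {e} a≈b c≈e = begin
    (a + c) % N             ≡⟨ %-distribˡ-+ a c N ⟩
    (a % N + c % N) % N     ≡⟨ cong₂ (λ x y → (x + y) % N) a≈b c≈e ⟩
    (b % N + e % N) % N     ≡⟨ %-distribˡ-+ b e N ⟨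
    (b + e) % N             ∎
    where open ≡-Reasoning

  *-cong : ∀ {a b c e} → a ≈ b → c ≈ e → a * c ≈ b * e
  *-cong {a} {b} {c} {e} a≈b c≈e = begin
    (a * c) % N             ≡⟨ %-distribˡ-* a c N ⟩
    (a % N * (c % N)) % N   ≡⟨ cong₂ (λ x y → (x * y) % N) a≈b c≈e ⟩
    (b % N * (e % N)) % N   ≡⟨ %-distribˡ-* b e N ⟨
    (b * e) % N             ∎
    where open ≡-Reasoning

  +-multiple : ∀ a k → a + k * N ≈ a
  +-multiple a k = [m+kn]%n≡m%n a k N

  %-≈ : ∀ a → a % N ≈ a
  %-≈ a = m%n%n≡m%n a N

  ≈⇒%≡ : ∀ {a b} → a ≈ b → b < N → a % N ≡ b
  ≈⇒%≡ a≈b b<N = trans a≈b (m<n⇒m%n≡m b<N)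

  inverse : ∀ {a} → Coprime a N → ∃[ u ] u * a ≈ 1
  inverse {a} cop with coprime-Bézout cop
  ... | GCD.Bézout.+- x y 1+yN≡xa = x , (begin
    x * a      ≡⟨ 1+yN≡xa ⟨
    1 + y * N  ≈⟨ +-multiple 1 y ⟩
    1          ∎)
    where open ≈-Reasoning
  -- Here a x ≡ −1, so (N ∸ 1) x ≡ −x is an inverse of a.
  ... | GCD.Bézout.-+ x y 1+xa≡yN = (N ∸ 1) * x , (begin
    (N ∸ 1) * x * a                ≈⟨ +-multiple _ 1 ⟨
    (N ∸ 1) * x * a + 1 * N        ≡⟨ cong (λ n → (N ∸ 1) * x * a + 1 * n) (suc-pred N) ⟨
    (N ∸ 1) * x * a + 1 * suc (N ∸ 1) ≡⟨ expand (N ∸ 1) x a ⟩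
    1 + (N ∸ 1) * (1 + x * a)      ≡⟨ cong (λ n → 1 + (N ∸ 1) * n) 1+xa≡yN ⟩
    1 + (N ∸ 1) * (y * N)          ≡⟨ cong (λ z → 1 + z) (*-assoc (N ∸ 1) y N) ⟨
    1 + (N ∸ 1) * y * N            ≈⟨ +-multiple 1 ((N ∸ 1) * y) ⟩
    1                              ∎)
    where
    open ≈-Reasoning
    expand : ∀ n x a → n * x * a + 1 * suc n ≡ 1 + n * (1 + x * a)
    expand = solve-∀

  *-cancelˡ : ∀ {u a b c} → u * a ≈ 1 → a * b ≈ a * c → b ≈ c
  *-cancelˡ {u} {a} {b} {c} ua≈1 ab≈ac = begin
    b           ≡⟨ *-identityˡ b ⟨
    1 * b       ≈⟨ *-cong ua≈1 ≈-refl ⟨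
    u * a * b   ≡⟨ *-assoc u a b ⟩
    u * (a * b) ≈⟨ *-cong {u} ≈-refl ab≈ac ⟩
    u * (a * c) ≡⟨ *-assoc u a c ⟨
    u * a * c   ≈⟨ *-cong ua≈1 ≈-refl ⟩
    1 * c       ≡⟨ *-identityˡ c ⟩
    c           ∎
    where open ≈-Reasoning

  multiple-+ : ∀ k a → N * k + a ≈ a
  multiple-+ k a =
    trans (cong (_% N) (trans (+-comm (N * k) a) (cong (λ z → a + z) (*-comm N k)))) (+-multiple a k)

module LinearCongruence (N : ℕ) .{{_ : NonZero N}} {a} (a⊥N : Coprime a N) (c : ℕ) where

  open Modular N

  private
    u : ℕ
    u = proj₁ (inverse a⊥N)

    u*a≈1 : u * a ≈ 1
    u*a≈1 = proj₂ (inverse a⊥N)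

    a*[u*m]≈m : ∀ m → a * (u * m) ≈ m
    a*[u*m]≈m m = begin
      a * (u * m) ≡⟨ *-assoc a u m ⟨
      a * u * m   ≡⟨ cong (_* m) (*-comm a u) ⟩
      u * a * m   ≈⟨ *-cong u*a≈1 ≈-refl ⟩
      1 * m       ≡⟨ *-identityˡ m ⟩
      m           ∎
      where open ≈-Reasoning

    -- Subtracting c modulo N is adding (N ∸ 1) c.
    +[N∸1]c+c≈ : ∀ m → m + (N ∸ 1) * c + c ≈ m
    +[N∸1]c+c≈ m = begin
      m + (N ∸ 1) * c + c       ≡⟨ regroup m c (N ∸ 1) ⟩
      m + c * suc (N ∸ 1)       ≡⟨ cong (λ n → m + c * n) (suc-pred N) ⟩
      m + c * N                 ≈⟨ +-multiple m c ⟩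
      m                         ∎
      where
      open ≈-Reasoning
      regroup : ∀ m c n → m + n * c + c ≡ m + c * suc n
      regroup = solve-∀

    +c≈⇒≈-c : ∀ {m t} → m + c ≈ t → m ≈ t + (N ∸ 1) * c
    +c≈⇒≈-c {m} {t} m+c≈t = begin
      m                         ≈⟨ +[N∸1]c+c≈ m ⟨
      m + (N ∸ 1) * c + c       ≡⟨ swap m ((N ∸ 1) * c) c ⟩
      m + c + (N ∸ 1) * c       ≈⟨ +-cong m+c≈t ≈-refl ⟩
      t + (N ∸ 1) * c           ∎
      where
      open ≈-Reasoning
      swap : ∀ m x c → m + x + c ≡ m + c + x
      swap = solve-∀

  root : ℕ → ℕ
  root t = u * (t + (N ∸ 1) * c) % N

  root<N : ∀ t → root t < N
  root<N t = m%n<n _ N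

  root-solves : ∀ t → a * root t + c ≈ t
  root-solves t = begin
    a * root t + c                  ≈⟨ +-cong (*-cong {a} ≈-refl (%-≈ (u * (t + (N ∸ 1) * c)))) ≈-refl ⟩
    a * (u * (t + (N ∸ 1) * c)) + c ≈⟨ +-cong (a*[u*m]≈m (t + (N ∸ 1) * c)) ≈-refl ⟩
    t + (N ∸ 1) * c + c             ≈⟨ +[N∸1]c+c≈ t ⟩
    t                               ∎
    where open ≈-Reasoning

  root-unique : ∀ {n t} → a * n + c ≈ t → n ≡ N * (n / N) + root t
  root-unique {n} {t} an+c≈t = trans (m≡n*[m/n]+m%n n N) (cong (λ z → N * (n / N) + z) n%N≡root)
    where
    n%N≡root : n % N ≡ root t
    n%N≡root = *-cancelˡ {u} u*a≈1
      (≈-trans (+c≈⇒≈-c an+c≈t) (≈-sym (a*[u*m]≈m (t + (N ∸ 1) * c))))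

  root-residue : ∀ {t} → t < N → (a * root t + c) % N ≡ t
  root-residue {t} t<N = ≈⇒%≡ (root-solves t) t<N

  root-injective : ∀ {t t'} → t < N → t' < N → root t ≡ root t' → t ≡ t'
  root-injective {t} {t'} t<N t'<N r≡r' =
    trans (sym (root-residue t<N)) (trans (cong (λ r → (a * r + c) % N) r≡r') (root-residue t'<N))

  carry : ℕ → ℕ
  carry t = (a * root t + c) / N

  root-division : ∀ {t} → t < N → a * root t + c ≡ N * carry t + t
  root-division {t} t<N = trans (m≡n*[m/n]+m%n _ N) (cong (λ z → N * carry t + z) (root-residue t<N))

  affine-root : ∀ {t} → t < N → ∀ p → a * (N * p + root t) + c ≡ N * (a * p + carry t) + t
  affine-root {t} t<N p = begin
    a * (N * p + root t) + c             ≡⟨ distrib a N p (root t) c ⟩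
    N * (a * p) + (a * root t + c)       ≡⟨ cong (λ z → N * (a * p) + z) (root-division t<N) ⟩
    N * (a * p) + (N * carry t + t)      ≡⟨ collect N (a * p) (carry t) t ⟩
    N * (a * p + carry t) + t            ∎
    where
    open ≡-Reasoning
    distrib : ∀ a N p r c → a * (N * p + r) + c ≡ N * (a * p) + (a * r + c)
    distrib = solve-∀
    collect : ∀ N x y t → N * x + (N * y + t) ≡ N * (x + y) + t
    collect = solve-∀

module OneStep (d g : ℕ) .{{_ : NonZero d}} .{{_ : NonZero g}} (g⊥d : Coprime g d)
               (a : ℕ) (a<g*g : a < g * g) (g∤a : ¬ g ∣ a) (e : ℕ) where

  X : ℕ
  X = d ^ e

  M : ℕ
  M = d * X

  instance
    X≢0 : NonZero X
    X≢0 = m^n≢0 d e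
    M≢0 : NonZero M
    M≢0 = m*n≢0 d X
    dg≢0 : NonZero (d * g)
    dg≢0 = m*n≢0 d g

  g*g⊥M : Coprime (g * g) M
  g*g⊥M = Cop.sym (coprime-*ʳ g⊥M g⊥M)
    where
    g⊥M : Coprime M g
    g⊥M = Cop.sym (coprime-^ʳ g⊥d (suc e))

  open LinearCongruence M g*g⊥M a

  X*digit<M : ∀ (j : Fin (d ∸ 1)) → X * digit j < M
  X*digit<M j = subst (X * digit j <_) (*-comm X d) (*-monoʳ-< X (digit<n j))

  -- q j is the residue of n modulo M for which (g² n + a) / X ≡ digit j (mod d).
  q : Fin (d ∸ 1) → ℕ
  q j = root (X * digit j)

  w : Fin (d ∸ 1) → ℕ
  w j = d * carry (X * digit j) + digit j

  q<M : ∀ j → q j < M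
  q<M j = root<N _

  q-injective : Injective _≡_ _≡_ q
  q-injective {i} {j} qi≡qj =
    digit-injective (*-cancelˡ-≡ _ _ X (root-injective (X*digit<M i) (X*digit<M j) qi≡qj))

  X*w≡ : ∀ j → X * w j ≡ g * g * q j + a
  X*w≡ j = begin
    X * w j                                ≡⟨ expand X d (carry (X * digit j)) (digit j) ⟩
    M * carry (X * digit j) + X * digit j  ≡⟨ root-division (X*digit<M j) ⟨
    g * g * q j + a                        ∎
    where
    open ≡-Reasoning
    expand : ∀ X d c j → X * (d * c + j) ≡ d * X * c + X * j
    expand = solve-∀

  step-affine : ∀ j p → g * g * (M * p + q j) + a ≡ X * (d * (g * g * p) + w j)
  step-affine j p = begin
    g * g * (M * p + q j) + a                             ≡⟨ affine-root (X*digit<M j) p ⟩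
    M * (g * g * p + carry (X * digit j)) + X * digit j   ≡⟨ regroup X d _ (carry (X * digit j)) (digit j) ⟩
    X * (d * (g * g * p) + w j)                           ∎
    where
    open ≡-Reasoning
    regroup : ∀ X d P c j → d * X * (P + c) + X * j ≡ X * (d * P + (d * c + j))
    regroup = solve-∀

  d∤w : ∀ j → ¬ d ∣ w j
  d∤w j d∣w = <⇒≱ (digit<n j) (∣⇒≤ (∣m+n∣m⇒∣n d∣w (m∣m*n _)))

  d∤d*m+w : ∀ m j → ¬ d ∣ d * m + w j
  d∤d*m+w m j d∣ = d∤w j (∣m+n∣m⇒∣n d∣ (m∣m*n m))

  classify : ∀ {n y} → g * g * n + a ≡ X * y → ¬ d ∣ y →
             ∃[ j ] n ≡ M * (n / M) + q j × y ≡ d * (g * g * (n / M)) + w j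
  classify {n} {y} g*g*n+a≡X*y d∤y with %-digit y d∤y
  ... | j , y%d≡digit = j , n≡ , *-cancelˡ-≡ _ _ X (begin
    X * y                                ≡⟨ g*g*n+a≡X*y ⟨
    g * g * n + a                        ≡⟨ cong (λ m → g * g * m + a) n≡ ⟩
    g * g * (M * (n / M) + q j) + a      ≡⟨ step-affine j (n / M) ⟩
    X * (d * (g * g * (n / M)) + w j)    ∎)
    where
    open ≡-Reasoning
    residue : (g * g * n + a) % M ≡ (X * digit j) % M
    residue = begin
      (g * g * n + a) % M  ≡⟨ cong (_% M) (trans g*g*n+a≡X*y (*-comm X y)) ⟩
      (y * X) % M          ≡⟨ m%n*o≡m*o%[n*o] y d X ⟨
      y % d * X            ≡⟨ cong (_* X) y%d≡digit ⟩
      digit j * X          ≡⟨ *-comm (digit j) X ⟩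
      X * digit j          ≡⟨ m<n⇒m%n≡m (X*digit<M j) ⟨
      (X * digit j) % M    ∎
    n≡ : n ≡ M * (n / M) + q j
    n≡ = root-unique residue

  w<g*[d*g] : ∀ j → w j < g * (d * g)
  w<g*[d*g] j = *-cancelˡ-< X (w j) (g * (d * g)) (begin-strict
    X * w j             ≡⟨ X*w≡ j ⟩
    g * g * q j + a     <⟨ n*o+m<n*p (g * g) a<g*g (q<M j) ⟩
    g * g * M           ≡⟨ regroup g d X ⟩
    X * (g * (d * g))   ∎)
    where
    open ≤-Reasoning
    regroup : ∀ g d X → g * g * (d * X) ≡ X * (g * (d * g))
    regroup = solve-∀

  1≤w : ∀ j → 1 ≤ w j
  1≤w j = ≤-trans (s≤s z≤n) (m≤n+m (digit j) _)

  r : Fin (d ∸ 1) → ℕ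
  r j = quot⁺ (w j) (d * g)

  δ : Fin (d ∸ 1) → ℕ
  δ j = rem⁺ (w j) (d * g)

  r<g : ∀ j → r j < g
  r<g j = quot⁺<n (d * g) (1≤w j) (<⇒≤ (w<g*[d*g] j))

  δ-InE : ∀ j → InE d g (δ j)
  δ-InE j = rem⁺-InE (1≤w j) (d∤w j) g∤w
    where
    g∤w : ¬ g ∣ w j
    g∤w g∣w = g∤a (∣m+n∣m⇒∣n (subst (g ∣_) (X*w≡ j) (∣-trans g∣w (n∣m*n X)))
                             (∣-trans (m∣m*n g) (m∣m*n (q j))))

  image≡ : ∀ j p → d * (g * g * p) + w j ≡ d * g * (g * p + r j) + δ j
  image≡ j p = begin
    d * (g * g * p) + w j
      ≡⟨ cong (λ z → d * (g * g * p) + z) (m≡n*quot⁺+rem⁺ (d * g) (1≤w j)) ⟩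
    d * (g * g * p) + (d * g * r j + δ j)    ≡⟨ regroup d g p (r j) (δ j) ⟩
    d * g * (g * p + r j) + δ j              ∎
    where
    open ≡-Reasoning
    regroup : ∀ d g p r δ → d * (g * g * p) + (d * g * r + δ) ≡ d * g * (g * p + r) + δ
    regroup = solve-∀

*+InE⇒InΠ : ∀ {d g ε} n → InE d g ε → InΠ d g (d * g * n + ε)
*+InE⇒InΠ {d} {g} {ε} n (1≤ε , _ , d∤ε , g∤ε) =
  ≤-trans 1≤ε (m≤n+m ε _) ,
  (λ d∣ → d∤ε (∣m+n∣m⇒∣n d∣ (∣-trans (m∣m*n g) (m∣m*n n)))) ,
  (λ g∣ → g∤ε (∣m+n∣m⇒∣n g∣ (∣-trans (n∣m*n d) (m∣m*n n))))

Path-cong : ∀ {d g h m} {ks : Vec ℕ m} {x x' z z'} → x ≡ x' → z ≡ z' →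
            Path d g h x ks z → Path d g h x' ks z'
Path-cong refl refl path = path

perturb : ∀ {g} m (c : ℤ) → g ∣ m → g ≤ m → 0 < ∣ c ∣ → ∣ c ∣ < g →
          ∃[ A ] + A ≡ + m ℤ.+ c × A < m + g × ¬ g ∣ A
perturb m (+ suc k) g∣m _ _ k<g =
  m + suc k , refl , +-monoʳ-< m k<g , λ g∣A → <⇒≱ k<g (∣⇒≤ (∣m+n∣m⇒∣n g∣A g∣m))
perturb {g} m -[1+ k ] g∣m g≤m _ k<g =
  m ∸ suc k , sym (ℤP.⊖-≥ 1+k≤m) , ≤-<-trans (m∸n≤m m (suc k)) (m<m+n m (≤-trans (s≤s z≤n) k<g)) ,
  λ g∣A → <⇒≱ k<g (∣⇒≤ (∣m+n∣m⇒∣n (subst (g ∣_) (sym (m∸n+n≡m 1+k≤m)) g∣m) g∣A))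
  where
  1+k≤m : suc k ≤ m
  1+k≤m = ≤-trans (<⇒≤ k<g) g≤m

module Dynamics (d g : ℕ) (h : ℤ → ℤ) (d⊥g : Coprime d g) (2≤d : 2 ≤ d) (d<g : d < g)
  (h-periodic : ∀ x → h (x ℤ.+ + d) ≡ h x)
  (d∣x+hx : ∀ x → + d ℤD.∣ (x ℤ.+ h x))
  (h-bounded : ∀ x → ¬ (+ d ℤD.∣ x) → 0 < ∣ h x ∣ × ∣ h x ∣ < g) where

  0<d : 0 < d
  0<d = ≤-trans (s≤s z≤n) 2≤d

  instance
    d≢0 : NonZero d
    d≢0 = >-nonZero 0<d
    g≢0 : NonZero g
    g≢0 = >-nonZero (<-trans 0<d d<g)
    dg≢0 : NonZero (d * g)
    dg≢0 = m*n≢0 d g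

  h-periodic* : ∀ x t → h (x ℤ.+ + (d * t)) ≡ h x
  h-periodic* x zero    = cong h (trans (cong (λ n → x ℤ.+ + n) (*-zeroʳ d)) (ℤP.+-identityʳ x))
  h-periodic* x (suc t) = begin
    h (x ℤ.+ + (d * suc t))          ≡⟨ cong (λ n → h (x ℤ.+ + n)) (*-suc d t) ⟩
    h (x ℤ.+ (+ d ℤ.+ + (d * t)))    ≡⟨ cong h (regroup x (+ d) (+ (d * t))) ⟩
    h (x ℤ.+ + (d * t) ℤ.+ + d)      ≡⟨ h-periodic _ ⟩
    h (x ℤ.+ + (d * t))              ≡⟨ h-periodic* x t ⟩
    h x                              ∎
    where
    open ≡-Reasoning
    regroup : ∀ x a b → x ℤ.+ (a ℤ.+ b) ≡ x ℤ.+ b ℤ.+ a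
    regroup = ℤS.solve-∀

  module Residue (ε : ℕ) (ε∈E : InE d g ε) where

    private
      d∤ε : ¬ d ∣ ε
      d∤ε = proj₁ (proj₂ (proj₂ ε∈E))

      ε<dg : ε < d * g
      ε<dg = ≤∧≢⇒< (proj₁ (proj₂ ε∈E)) (λ ε≡dg → d∤ε (subst (d ∣_) (sym ε≡dg) (m∣m*n g)))

      c : ℤ
      c = h (+ (g * ε))

      d∤gε : ¬ + d ℤD.∣ + (g * ε)
      d∤gε = d∤ε ∘ coprime-divisor d⊥g

      g≤gε : g ≤ g * ε
      g≤gε = subst (_≤ g * ε) (*-identityʳ g) (*-monoʳ-≤ g (proj₁ ε∈E))

      A-spec : ∃[ A ] + A ≡ + (g * ε) ℤ.+ c × A < g * ε + g × ¬ g ∣ A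
      A-spec = perturb (g * ε) c (m∣m*n ε) g≤gε (proj₁ (h-bounded _ d∤gε)) (proj₂ (h-bounded _ d∤gε))

      A : ℕ
      A = proj₁ A-spec

      +A≡ : + A ≡ + (g * ε) ℤ.+ c
      +A≡ = proj₁ (proj₂ A-spec)

    a : ℕ
    a = A / d

    private
      d*a≡A : d * a ≡ A
      d*a≡A = m*[n/m]≡n (subst (λ z → d ∣ ∣ z ∣) (sym +A≡) (d∣x+hx (+ (g * ε))))

    a<g*g : a < g * g
    a<g*g = *-cancelˡ-< d a (g * g) (begin-strict
      d * a          ≡⟨ d*a≡A ⟩
      A              <⟨ proj₁ (proj₂ (proj₂ A-spec)) ⟩
      g * ε + g      ≡⟨ trans (+-comm (g * ε) g) (sym (*-suc g ε)) ⟩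
      g * suc ε      ≤⟨ *-monoʳ-≤ g ε<dg ⟩
      g * (d * g)    ≡⟨ regroup g d ⟩
      d * (g * g)    ∎)
      where
      open ≤-Reasoning
      regroup : ∀ g d → g * (d * g) ≡ d * (g * g)
      regroup = solve-∀

    g∤a : ¬ g ∣ a
    g∤a g∣a = proj₂ (proj₂ (proj₂ A-spec)) (subst (g ∣_) d*a≡A (∣-trans g∣a (n∣m*n d)))

    numerator : ∀ n → let x = d * g * n + ε in + (g * x) ℤ.+ h (+ (g * x)) ≡ + (d * (g * g * n + a))
    numerator n = begin
      + (g * (d * g * n + ε)) ℤ.+ h (+ (g * (d * g * n + ε)))
        ≡⟨ cong (λ m → + m ℤ.+ h (+ m)) (expand g d n ε) ⟩
      (gε ℤ.+ shift) ℤ.+ h (gε ℤ.+ shift)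
        ≡⟨ cong (λ z → (gε ℤ.+ shift) ℤ.+ z) (h-periodic* gε (g * g * n)) ⟩
      (gε ℤ.+ shift) ℤ.+ c
        ≡⟨ swap gε shift c ⟩
      (gε ℤ.+ c) ℤ.+ shift
        ≡⟨ cong (ℤ._+ shift) (trans (sym +A≡) (cong +_ (sym d*a≡A))) ⟩
      + (d * a + d * (g * g * n))
        ≡⟨ cong +_ (trans (sym (*-distribˡ-+ d a _)) (cong (d *_) (+-comm a _))) ⟩
      + (d * (g * g * n + a))
        ∎
      where
      open ≡-Reasoning
      gε shift : ℤ
      gε = + (g * ε)
      shift = + (d * (g * g * n))
      expand : ∀ g d n ε → g * (d * g * n + ε) ≡ g * ε + d * (g * g * n)
      expand = solve-∀
      swap : ∀ x y z → x ℤ.+ y ℤ.+ z ≡ x ℤ.+ z ℤ.+ y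
      swap = ℤS.solve-∀

    step⇒ : ∀ {n e y} → Step d g h (d * g * n + ε) (suc e) y → g * g * n + a ≡ d ^ e * y × ¬ d ∣ y
    step⇒ {n} {e} {y} (_ , eq , d∤y) = *-cancelˡ-≡ _ _ d (begin
      d * (g * g * n + a)  ≡⟨ ℤP.+-injective (trans (sym (numerator n)) eq) ⟩
      d ^ suc e * y        ≡⟨ *-assoc d (d ^ e) y ⟩
      d * (d ^ e * y)      ∎) , d∤y
      where open ≡-Reasoning

    step⇐ : ∀ {n e y} → g * g * n + a ≡ d ^ e * y → ¬ d ∣ y → Step d g h (d * g * n + ε) (suc e) y
    step⇐ {n} {e} {y} eq d∤y =
      s≤s z≤n , trans (numerator n) (cong +_ (trans (cong (d *_) eq) (sym (*-assoc d (d ^ e) y)))) , d∤y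

  record StepFamily (ε k : ℕ) : Set where
    field
      q r δ       : Fin (d ∸ 1) → ℕ
      q-injective : Injective _≡_ _≡_ q
      q<dᵏ        : ∀ j → q j < d ^ k
      r<g         : ∀ j → r j < g
      δ-InE       : ∀ j → InE d g (δ j)
      complete    : ∀ {n y} → Step d g h (d * g * n + ε) k y →
                    ∃[ p ] ∃[ j ] n ≡ d ^ k * p + q j × y ≡ d * g * (g * p + r j) + δ j
      sound       : ∀ p j → Step d g h (d * g * (d ^ k * p + q j) + ε) k (d * g * (g * p + r j) + δ j)

  stepFamily : ∀ {ε} → InE d g ε → ∀ k → 1 ≤ k → StepFamily ε k
  stepFamily {ε} ε∈E (suc e) _ = record
    { q = q ; r = r ; δ = δ ; q-injective = q-injective ; q<dᵏ = q<M ; r<g = r<g ; δ-InE = δ-InE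
    ; complete = complete ; sound = sound }
    where
    open Residue ε ε∈E
    open OneStep d g (Cop.sym d⊥g) a a<g*g g∤a e

    complete : ∀ {n y} → Step d g h (d * g * n + ε) (suc e) y →
               ∃[ p ] ∃[ j ] n ≡ M * p + q j × y ≡ d * g * (g * p + r j) + δ j
    complete {n} st =
      let eq , d∤y = step⇒ st
          j , n≡ , y≡ = classify eq d∤y
      in  n / M , j , n≡ , trans y≡ (image≡ j (n / M))

    sound : ∀ p j → Step d g h (d * g * (M * p + q j) + ε) (suc e) (d * g * (g * p + r j) + δ j)
    sound p j = step⇐ (trans (step-affine j p) (cong (X *_) (image≡ j p)))
                      (d∤d*m+w (g * g * p) j ∘ subst (d ∣_) (sym (image≡ j p)))

  record PathFamily {m} (ks : Vec ℕ m) (ε : ℕ) : Set where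
    field
      q r δ       : Fin ((d ∸ 1) ^ m) → ℕ
      q-injective : Injective _≡_ _≡_ q
      bounds      : ∀ i → q i < d ^ sum ks × r i < g ^ m × InE d g (δ i)
      complete    : ∀ {n z} → Path d g h (d * g * n + ε) ks z →
                    ∃[ p ] ∃[ i ] n ≡ d ^ sum ks * p + q i
      sound       : ∀ p i → Path d g h (d * g * (d ^ sum ks * p + q i) + ε) ks
                                       (d * g * (g ^ m * p + r i) + δ i)

  emptyFamily : ∀ {ε} → InE d g ε → PathFamily [] ε
  emptyFamily {ε} ε∈E = record
    { q = λ _ → 0 ; r = λ _ → 0 ; δ = λ _ → ε
    ; q-injective = λ { {Fin.zero} {Fin.zero} _ → refl }
    ; bounds      = λ _ → s≤s z≤n , s≤s z≤n , ε∈E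
    ; complete    = λ {n} _ → n , Fin.zero , sym (trans (+-identityʳ _) (*-identityˡ n))
    ; sound       = λ _ _ → done }

  module Compose {ε k m} {ks : Vec ℕ m}
                 (S : StepFamily ε k) (F : ∀ j → PathFamily ks (StepFamily.δ S j)) where

    module S = StepFamily S
    module F j = PathFamily (F j)

    D : ℕ
    D = d ^ sum ks

    instance
      D≢0 : NonZero D
      D≢0 = m^n≢0 d (sum ks)
      dᵏ≢0 : NonZero (d ^ k)
      dᵏ≢0 = m^n≢0 d k

    module L j = LinearCongruence D (coprime-^ʳ (Cop.sym d⊥g) (sum ks)) (S.r j)

    s t : Fin (d ∸ 1) → Fin ((d ∸ 1) ^ m) → ℕ
    s j i = L.root j (F.q j i)
    t j i = L.carry j (F.q j i)

    Q R : Fin (d ∸ 1) → Fin ((d ∸ 1) ^ m) → ℕ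
    Q j i = d ^ k * s j i + S.q j
    R j i = g ^ m * t j i + F.r j i

    F-q<D : ∀ j i → F.q j i < D
    F-q<D j i = proj₁ (F.bounds j i)

    shift-start : ∀ j i p → d ^ (k + sum ks) * p + Q j i ≡ d ^ k * (D * p + s j i) + S.q j
    shift-start j i p = begin
      d ^ (k + sum ks) * p + Q j i          ≡⟨ cong (λ x → x * p + Q j i) (^-distribˡ-+-* d k (sum ks)) ⟩
      d ^ k * D * p + (d ^ k * s j i + S.q j) ≡⟨ regroup (d ^ k) D p (s j i) (S.q j) ⟩
      d ^ k * (D * p + s j i) + S.q j         ∎
      where
      open ≡-Reasoning
      regroup : ∀ A D p s q → A * D * p + (A * s + q) ≡ A * (D * p + s) + q
      regroup = solve-∀

    shift-end : ∀ j i p → g ^ m * (g * p + t j i) + F.r j i ≡ g ^ suc m * p + R j i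
    shift-end j i p = regroup (g ^ m) g p (t j i) (F.r j i)
      where
      regroup : ∀ G g p t r → G * (g * p + t) + r ≡ g * G * p + (G * t + r)
      regroup = solve-∀

    sound : ∀ j i p → Path d g h (d * g * (d ^ (k + sum ks) * p + Q j i) + ε) (k ∷ ks)
                                 (d * g * (g ^ suc m * p + R j i) + F.δ j i)
    sound j i p =
      Path-cong (cong (λ x → d * g * x + ε) (sym (shift-start j i p)))
                (cong (λ x → d * g * x + F.δ j i) (shift-end j i p))
        (step (S.sound (D * p + s j i) j)
              (Path-cong (cong (λ x → d * g * x + S.δ j) (sym (L.affine-root j (F-q<D j i) p))) refl
                (F.sound j (g * p + t j i) i)))

    complete : ∀ {n z} → Path d g h (d * g * n + ε) (k ∷ ks) z →
               ∃[ p ] ∃[ j ] ∃[ i ] n ≡ d ^ (k + sum ks) * p + Q j i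
    complete {n} (step st rest) =
      let p , j , n≡ , y≡ = S.complete st
          _ , i , g*p+r≡   = F.complete j (Path-cong y≡ refl rest)
          p≡               = L.root-unique j (trans (cong (_% D) g*p+r≡) (multiple-+ _ (F.q j i)))
      in  p / D , j , i , trans n≡ (trans (cong (λ x → d ^ k * x + S.q j) p≡) (sym (shift-start j i (p / D))))
      where open Modular D using (multiple-+)

    Q-injective : ∀ {j i j' i'} → Q j i ≡ Q j' i' → (j , i) ≡ (j' , i')
    Q-injective {j} {i} {j'} {i'} Q≡Q' with S.q-injective (begin
      S.q j                          ≡⟨ [n*o+m]%n≡m (d ^ k) (s j i) (S.q<dᵏ j) ⟨
      (d ^ k * s j i + S.q j) % d ^ k   ≡⟨ cong (_% d ^ k) Q≡Q' ⟩
      (d ^ k * s j' i' + S.q j') % d ^ k ≡⟨ [n*o+m]%n≡m (d ^ k) (s j' i') (S.q<dᵏ j') ⟩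
      S.q j'                         ∎)
      where open ≡-Reasoning
    ... | refl = cong (j ,_) (F.q-injective j
                   (L.root-injective j (F-q<D j i) (F-q<D j i')
                     (*-cancelˡ-≡ _ _ (d ^ k) (+-cancelʳ-≡ _ _ _ Q≡Q'))))

    t<g : ∀ j i → t j i < g
    t<g j i = m<n*o⇒m/o<n (n*o+m<n*p g (S.r<g j) (L.root<N j (F.q j i)))

    bounds : ∀ j i → Q j i < d ^ (k + sum ks) × R j i < g ^ suc m × InE d g (F.δ j i)
    bounds j i =
      subst (Q j i <_) (sym (^-distribˡ-+-* d k (sum ks)))
        (n*o+m<n*p (d ^ k) (S.q<dᵏ j) (L.root<N j (F.q j i))) ,
      subst (R j i <_) (*-comm (g ^ m) g) (n*o+m<n*p (g ^ m) (proj₁ (proj₂ (F.bounds j i))) (t<g j i)) ,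
      proj₂ (proj₂ (F.bounds j i))

    split : Fin ((d ∸ 1) ^ suc m) → Fin (d ∸ 1) × Fin ((d ∸ 1) ^ m)
    split = remQuot ((d ∸ 1) ^ m)

    family : PathFamily (k ∷ ks) ε
    family = record
      { q = uncurry Q ∘ split ; r = uncurry R ∘ split ; δ = uncurry F.δ ∘ split
      ; q-injective = uncurry-remQuot-injective Q Q-injective
      ; bounds   = λ c → uncurry bounds (split c)
      ; complete = λ path →
          let p , j , i , n≡ = complete path
          in  p , combine j i ,
              trans n≡ (cong (λ ji → d ^ (k + sum ks) * p + uncurry Q ji) (sym (remQuot-combine j i)))
      ; sound    = λ p c → sound (proj₁ (split c)) (proj₂ (split c)) p }

  pathFamily : ∀ {m} (ks : Vec ℕ m) → All (1 ≤_) ks → ∀ {ε} → InE d g ε → PathFamily ks ε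
  pathFamily []       []          ε∈E = emptyFamily ε∈E
  pathFamily (k ∷ ks) (1≤k ∷ 1≤ks) ε∈E =
    Compose.family S (λ j → pathFamily ks 1≤ks (StepFamily.δ-InE S j))
    where
    S = stepFamily ε∈E k 1≤k

∣+m-+n∣≡m∸n : ∀ {m n} → n ≤ m → ∣ + m ℤ.- + n ∣ ≡ m ∸ n
∣+m-+n∣≡m∸n {m} {n} n≤m = cong ∣_∣ (trans (ℤP.m-n≡m⊖n m n) (ℤP.⊖-≥ n≤m))

∣-ε⇒≡*+ε : ∀ {N x ε} .{{_ : NonZero N}} → 0 < x → ε ≤ N →
           + N ℤD.∣ (+ x ℤ.- + ε) → ∃[ n ] x ≡ N * n + ε
∣-ε⇒≡*+ε {N} {x} {ε} 0<x ε≤N N∣x-ε with ≤-<-connex ε x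
... | inj₁ ε≤x =
  let divides n x∸ε≡nN = subst (N ∣_) (∣+m-+n∣≡m∸n ε≤x) N∣x-ε
  in  n , trans (sym (m∸n+n≡m ε≤x)) (cong (_+ ε) (trans x∸ε≡nN (*-comm n N)))
... | inj₂ x<ε = contradiction ε≤N (<⇒≱ (begin-strict
  N      ≤⟨ ∣⇒≤ {{>-nonZero (m<n⇒0<n∸m x<ε)}} (subst (N ∣_) ε-x≡ N∣x-ε) ⟩
  ε ∸ x  <⟨ ∸-monoʳ-< 0<x (<⇒≤ x<ε) ⟩
  ε      ∎))
  where
  open ≤-Reasoning
  ε-x≡ : ∣ + x ℤ.- + ε ∣ ≡ ε ∸ x
  ε-x≡ = trans (cong ∣_∣ (ℤP.m-n≡m⊖n x ε))
               (trans (ℤP.∣m⊖n∣≡∣n⊖m∣ x ε) (cong ∣_∣ (ℤP.⊖-≥ (<⇒≤ x<ε))))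

∣[*+ε]-ε : ∀ N n ε → + N ℤD.∣ (+ (N * n + ε) ℤ.- + ε)
∣[*+ε]-ε N n ε =
  subst (N ∣_) (sym (trans (∣+m-+n∣≡m∸n (m≤n+m ε (N * n))) (m+n∸n≡m (N * n) ε))) (m∣m*n n)

mainTheorem1 : (d g : ℕ) (h : ℤ → ℤ) →
  Coprime d g → 2 ≤ d → d < g →
  (∀ x → h (x ℤ.+ + d) ≡ h x) →
  (∀ x → (+ d) ℤD.∣ (x ℤ.+ h x)) →
  (∀ x → ¬ ((+ d) ℤD.∣ x) → (0 < ∣ h x ∣ × ∣ h x ∣ < g)) →
  (m : ℕ) → 1 ≤ m → (ks : Vec ℕ m) → All (1 ≤_) ks →
  (ε : ℕ) → InE d g ε →
  Σ (Fin ((d ∸ 1) ^ m) → ℕ) λ q →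
  Σ (Fin ((d ∸ 1) ^ m) → ℕ) λ r →
  Σ (Fin ((d ∸ 1) ^ m) → ℕ) λ δ →
    Injective _≡_ _≡_ q
    × (∀ i → q i < d ^ sum ks × r i < g ^ m × InE d g (δ i))
    × (∀ x →
        ((InΠ d g x × (+ (d * g)) ℤD.∣ (+ x ℤ.- + ε) × ∃[ z ] Path d g h x ks z)
          → ∃[ p ] ∃[ i ] x ≡ d * g * (d ^ sum ks * p + q i) + ε)
        × ((∃[ p ] ∃[ i ] x ≡ d * g * (d ^ sum ks * p + q i) + ε)
          → (InΠ d g x × (+ (d * g)) ℤD.∣ (+ x ℤ.- + ε) × ∃[ z ] Path d g h x ks z)))
    × (∀ p i → Path d g h (d * g * (d ^ sum ks * p + q i) + ε) ks
                          (d * g * (g ^ m * p + r i) + δ i))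
-- The construction also covers m = 0.
mainTheorem1 d g h d⊥g 2≤d d<g h-periodic d∣x+hx h-bounded m _ ks 1≤ks ε ε∈E =
  q , r , δ , q-injective , bounds , (λ x → class⊆family , family⊆class) , sound
  where
  open Dynamics d g h d⊥g 2≤d d<g h-periodic d∣x+hx h-bounded
  open PathFamily (pathFamily ks 1≤ks ε∈E)

  class⊆family : ∀ {x} → InΠ d g x × + (d * g) ℤD.∣ (+ x ℤ.- + ε) × ∃[ z ] Path d g h x ks z →
            ∃[ p ] ∃[ i ] x ≡ d * g * (d ^ sum ks * p + q i) + ε
  class⊆family ((0<x , _) , dg∣x-ε , _ , path) =
    let n , x≡ = ∣-ε⇒≡*+ε 0<x (proj₁ (proj₂ ε∈E)) dg∣x-ε
        p , i , n≡ = complete (Path-cong x≡ refl path)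
    in  p , i , trans x≡ (cong (λ n → d * g * n + ε) n≡)

  family⊆class : ∀ {x} → ∃[ p ] ∃[ i ] x ≡ d * g * (d ^ sum ks * p + q i) + ε →
               InΠ d g x × + (d * g) ℤD.∣ (+ x ℤ.- + ε) × ∃[ z ] Path d g h x ks z
  family⊆class (p , i , refl) = *+InE⇒InΠ _ ε∈E , ∣[*+ε]-ε (d * g) _ ε , _ , sound p i
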